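{- Let $\chi,\check\phi$ be formulas over $\vec{x}$ and $\vec{a}:\mathbb{Z}^d\to\mathbb{Z}^d$, with $\chi(\vec{x})\equiv\bigwedge_{i=1}^k C_i$ where each clause $C_i$ contains a literal $\mathit{expr}_i(\vec{x})>0$ such that for all $\vec{x}\in\mathbb{Z}^d$: $\check\phi(\vec{x})\land\mathit{expr}_i(\vec{x})\le\mathit{expr}_i(\vec{a}(\vec{x}))\implies\mathit{expr}_i(\vec{a}(\vec{x}))\le\mathit{expr}_i(\vec{a}^2(\vec{x}))$. Then the conditional acceleration technique $(\langle\chi,\vec{a}\rangle,\check\phi)\mapsto\vec{x}'=\vec{a}^n(\vec{x})\land\bigwedge_{i=1}^k 0<\mathit{expr}_i(\vec{x})\le\mathit{expr}_i(\vec{a}(\vec{x}))$ is sound; that is, for all $\vec{x},\vec{x}'\in\mathbb{Z}^d$ and $n>0$, if $\vec{x}\longrightarrow^n_{\langle\check\phi,\vec{a}\rangle}\vec{x}'$ and this formula holds, then $\vec{x}\longrightarrow^n_{\langle\chi,\vec{a}\rangle}\vec{x}'$.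
   Context: $\vec{x}=(x_1,\dots,x_d)$ ranges over $\mathbb{Z}^d$, $n$ is a variable, $\vec{x}'=(x_1',\dots,x_d')$. Formulas are finite quantifier-free propositional formulas in CNF with atoms $p>0$, $p$ a closed-form arithmetic expression. For a formula $\phi$ over $\vec{x}$ and $\vec{a}:\mathbb{Z}^d\to\mathbb{Z}^d$, the loop $\langle\phi,\vec{a}\rangle$ induces $\vec{x}\longrightarrow_{\langle\phi,\vec{a}\rangle}\vec{x}'$ iff $\phi(\vec{x})\land\vec{x}'=\vec{a}(\vec{x})$; $\longrightarrow^n$ is its $n$-fold composition and $\vec{a}^n$ the $n$-fold application of $\vec{a}$ ($\vec{a}^0=\mathrm{id}$). A conditional acceleration technique is a partial function $\mathit{accel}$ mapping pairs (loop $\langle\chi,\vec{a}\rangle$, formula $\check\phi$) to formulas over $(\vec{x},n,\vec{x}')$; it is sound if for all arguments in its domain, $\vec{x},\vec{x}'\in\mathbb{Z}^d$, $n>0$: $\vec{x}\longrightarrow^n_{\langle\check\phi,\vec{a}\rangle}\vec{x}'\land\mathit{accel}(\langle\chi,\vec{a}\rangle,\check\phi)$ implies $\vec{x}\longrightarrow^n_{\langle\chi,\vec{a}\rangle}\vec{x}'$. -}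

module Defs where

open import Data.Nat using (ℕ; zero; suc)
open import Data.Integer using (ℤ; _<_; _≤_; +_)
open import Data.Vec using (Vec; toList)
open import Data.Fin using (Fin)
open import Data.List using (List)
open import Data.List.Relation.Unary.All using (All)
open import Data.List.Relation.Unary.Any using (Any)
open import Data.Product using (Σ; _×_)
open import Relation.Binary.PropositionalEquality using (_≡_)

Pt : ℕ → Set
Pt d = Vec ℤ d

Expr : ℕ → Set
Expr d = Pt d → ℤ

-- A clause is a disjunction of literals  p > 0 ; a formula is a CNF,
-- i.e. a conjunction (list) of clauses.
Clause : ℕ → Set
Clause d = List (Expr d)

Formula : ℕ → Set
Formula d = List (Clause d)

⟦_⟧ᶜ : ∀ {d} → Clause d → Pt d → Set
⟦ C ⟧ᶜ x = Any (λ p → + 0 < p x) C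

⟦_⟧ : ∀ {d} → Formula d → Pt d → Set
⟦ φ ⟧ x = All (λ C → ⟦ C ⟧ᶜ x) φ

iter : ∀ {d} → (Pt d → Pt d) → ℕ → Pt d → Pt d
iter a zero x = x
iter a (suc n) x = iter a n (a x)

Step : ∀ {d} → Formula d → (Pt d → Pt d) → Pt d → Pt d → Set
Step φ a x x' = ⟦ φ ⟧ x × x' ≡ a x

Steps : ∀ {d} → Formula d → (Pt d → Pt d) → ℕ → Pt d → Pt d → Set
Steps φ a zero x x' = x ≡ x'
Steps φ a (suc n) x x' = Σ (Pt _) (λ y → Step φ a x y × Steps φ a n y x')

AccelFormula : ∀ {d k} → (Fin k → Expr d) → (Pt d → Pt d) → Pt d → ℕ → Pt d → Set
AccelFormula {d} {k} e a x n x' =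
  x' ≡ iter a n x × ((i : Fin k) → (+ 0 < e i x) × (e i x ≤ e i (a x)))

-- The conjunction of  0 < exprᵢ(x⃗) ≤ exprᵢ(a⃗(x⃗))  holds initially and is an invariant
-- of the φ̌-steps: positivity propagates along ≤, and the hypothesis propagates the ≤.
-- Since each clause Cᵢ contains exprᵢ > 0, the invariant implies χ, so every step of the
-- φ̌-run is also a χ-step.
module Submission where

open import Defs
open import Data.Nat using (ℕ; suc; zero)
open import Data.Integer using (_≤_; _<_; +_)
open import Data.Integer.Properties using (<-≤-trans)
open import Data.Vec using (Vec; toList; lookup)
open import Data.Vec.Relation.Unary.All.Properties using (lookup⁻; toList⁺)
open import Data.Fin using (Fin)
open import Data.List.Membership.Propositional using (_∈_; lose)
open import Data.Product using (_,_; _×_; proj₁)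
open import Relation.Binary.PropositionalEquality using (refl)

Steps-strengthen : ∀ {d} {φ ψ : Formula d} {a : Pt d → Pt d} (P : Pt d → Set)
  → (∀ {y} → ⟦ φ ⟧ y → P y → P (a y))
  → (∀ {y} → P y → ⟦ ψ ⟧ y)
  → ∀ m {y x'} → P y → Steps φ a m y x' → Steps ψ a m y x'
Steps-strengthen P preserve sound zero Py y≡x' = y≡x'
Steps-strengthen P preserve sound (suc m) Py (_ , (φy , refl) , rest) =
  _ , (sound Py , refl) , Steps-strengthen P preserve sound m (preserve φy Py) rest

Increasing : ∀ {d k} → (Fin k → Expr d) → (Pt d → Pt d) → Pt d → Set
Increasing e a y = ∀ i → (+ 0 < e i y) × (e i y ≤ e i (a y))

Increasing-step : ∀ {d k} (φ̌ : Formula d) (a : Pt d → Pt d) (e : Fin k → Expr d)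
  → (∀ i x → ⟦ φ̌ ⟧ x → e i x ≤ e i (a x) → e i (a x) ≤ e i (iter a 2 x))
  → ∀ {y} → ⟦ φ̌ ⟧ y → Increasing e a y → Increasing e a (a y)
Increasing-step φ̌ a e mono φ̌y inc i with inc i
... | pos , ≤a = <-≤-trans pos ≤a , mono i _ φ̌y ≤a

⟦⟧-positive : ∀ {d k} (χ : Vec (Clause d) k) (e : Fin k → Expr d)
  → (∀ i → e i ∈ lookup χ i)
  → ∀ {y} → (∀ i → + 0 < e i y) → ⟦ toList χ ⟧ y
⟦⟧-positive χ e mem pos = toList⁺ (lookup⁻ (λ i → lose (mem i) (pos i)))

theorem13 : {d k : ℕ} (χ : Vec (Clause d) k) (φ̌ : Formula d) (a : Pt d → Pt d)
    (e : Fin k → Expr d) → ((i : Fin k) → e i ∈ lookup χ i)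
    → ((i : Fin k) (x : Pt d) → ⟦ φ̌ ⟧ x → e i x ≤ e i (a x) → e i (a x) ≤ e i (iter a 2 x))
    → (x x' : Pt d) (n : ℕ)
    → Steps φ̌ a (suc n) x x' → AccelFormula e a x (suc n) x'
    → Steps (toList χ) a (suc n) x x'
theorem13 χ φ̌ a e mem mono x x' n run (_ , increasing) =
  Steps-strengthen (Increasing e a)
    (Increasing-step φ̌ a e mono)
    (λ inc → ⟦⟧-positive χ e mem (λ i → proj₁ (inc i)))
    (suc n) increasing run
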